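{- For every $k\ge1$, with $n=3^k$, $\mathsf{D}_{\oplus}(\mathrm{MAJ}_3^{\otimes k})\le (n+1)/2$.
   Context: $\mathrm{MAJ}_3\colon\{0,1\}^3\to\{ -1,1\}$ takes value $-1$ iff at least two inputs are $1$ (the value $-1$ being interpreted as true/bit $1$). The recursive majority $\mathrm{MAJ}_3^{\otimes k}$ on $n=3^k$ variables is defined by $\mathrm{MAJ}_3^{\otimes 1}=\mathrm{MAJ}_3$ and, for $k>1$, $\mathrm{MAJ}_3^{\otimes k}=\mathrm{MAJ}_3(\mathrm{MAJ}_3^{\otimes k-1},\mathrm{MAJ}_3^{\otimes k-1},\mathrm{MAJ}_3^{\otimes k-1})$, where the three inner copies are applied to three disjoint blocks of $3^{k-1}$ variables. A parity decision tree is a rooted binary tree whose internal nodes are labeled by parities $\bigoplus_{i\in S}x_i$, with two outgoing edges labeled by the possible parity values, and leaves labeled by $-1$ or $1$; $\mathsf{D}_{\oplus}(f)$ is the minimal depth of such a tree computing $f$. -}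

module Defs where

open import Data.Bool using (Bool; true; false; _xor_; _∧_; _∨_; if_then_else_)
open import Data.Nat using (ℕ; zero; suc; _+_; _*_; _^_; _⊔_)
open import Data.Vec using (Vec; []; _∷_; splitAt; lookup)
open import Data.Fin using (Fin)
open import Data.Product using (_×_; _,_)
open import Relation.Binary.PropositionalEquality using (_≡_)

-- Conventions: an input bit x_i ∈ {0,1} is a Bool (true = 1).
-- An output value in {-1,1} is a Bool with true = -1 (interpreted as
-- true / bit 1) and false = +1.

MAJ3 : Bool → Bool → Bool → Bool
MAJ3 a b c = (a ∧ b) ∨ (a ∧ c) ∨ (b ∧ c)

split3 : ∀ {A : Set} m → Vec A (m + (m + (m + 0))) → Vec A m × Vec A m × Vec A m
split3 m v with splitAt m v
... | (u , w , _) with splitAt m w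
... | (u' , w' , _) with splitAt m w'
... | (u'' , _ , _) = u , u' , u''

-- RecMaj 0 is the identity on one
-- variable (auxiliary base case), so RecMaj 1 x = MAJ3 x0 x1 x2 and
-- RecMaj (k+1) = MAJ3 applied to three copies of RecMaj k on disjoint blocks,
-- matching MAJ_3^{⊗k} for every k ≥ 1.
RecMaj : (k : ℕ) → Vec Bool (3 ^ k) → Bool
RecMaj zero (x ∷ []) = x
RecMaj (suc k) v with split3 (3 ^ k) v
... | (a , b , c) = MAJ3 (RecMaj k a) (RecMaj k b) (RecMaj k c)

-- Parity of the bits of x indexed by S (S : Vec Bool n, true = i ∈ S).
parity : ∀ {n} → Vec Bool n → Vec Bool n → Bool
parity [] [] = false
parity (s ∷ S) (x ∷ xs) = (s ∧ x) xor parity S xs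

data PDT (n : ℕ) : Set where
  leaf : Bool → PDT n
  node : Vec Bool n → PDT n → PDT n → PDT n

depth : ∀ {n} → PDT n → ℕ
depth (leaf _) = 0
depth (node _ t₀ t₁) = suc (depth t₀ ⊔ depth t₁)

eval : ∀ {n} → PDT n → Vec Bool n → Bool
eval (leaf b) x = b
eval (node S t₀ t₁) x = if parity S x then eval t₁ x else eval t₀ x

Computes : ∀ {n} → PDT n → (Vec Bool n → Bool) → Set
Computes T f = ∀ x → eval T x ≡ f x

-- MAJ3 a b c equals c when a ⊕ b = 1 and a otherwise, so a majority of three
-- subformulas costs the parity a ⊕ b of two of them plus one further
-- subformula.  Parities of the leaves never need to be queried on their own:
-- they are ⊕-ed into an accumulated, still unqueried parity that a later query
-- reads off together with whatever follows.  If c j queries are spent on a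
-- formula of height j, then c (j + 1) = 3 c j + 1, i.e. c j = (3^j - 1)/2, and
-- one last query of the accumulated parity gives depth (3^k + 1)/2.
module Submission where

open import Defs
open import Data.Nat using (ℕ; _≤_; _+_; _^_; _/_)
open import Data.Product using (Σ; _×_)

open import Algebra.Bundles using (CommutativeRing)
open import Data.Bool using (Bool; true; false; _xor_; _∧_; if_then_else_)
open import Data.Bool.Properties
  using (xor-assoc; xor-identityʳ; ∧-distribʳ-xor; if-float; xor-∧-commutativeRing)
open import Data.Nat using (zero; suc; _*_; s≤s)
open import Data.Nat.DivMod using (m*n/n≡m)
open import Data.Nat.Properties using (≤-refl; ≤-trans; +-identityʳ; +-monoˡ-≤; ⊔-lub; m≤m⊔n; m≤n⊔m)
open import Data.Nat.Tactic.RingSolver using (solve-∀)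
open import Data.Product using (_,_)
open import Data.Vec using (Vec; []; _∷_; map; replicate; zipWith; take; drop)
open import Data.Vec.Properties using (take-map; drop-map; map-∘)
open import Relation.Binary.PropositionalEquality
  using (_≡_; refl; sym; trans; cong; cong₂; subst; module ≡-Reasoning)

open import Algebra.Properties.CommutativeSemigroup
  (CommutativeRing.+-commutativeSemigroup xor-∧-commutativeRing) using (interchange)

parity-replicate-false : ∀ {n} (x : Vec Bool n) → parity (replicate n false) x ≡ false
parity-replicate-false [] = refl
parity-replicate-false (_ ∷ xs) = parity-replicate-false xs

parity-zipWith-xor : ∀ {n} (S T x : Vec Bool n) →
  parity (zipWith _xor_ S T) x ≡ parity S x xor parity T x
parity-zipWith-xor [] [] [] = refl
parity-zipWith-xor (s ∷ S) (t ∷ T) (x ∷ xs) =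
  trans (cong₂ _xor_ (∧-distribʳ-xor x s t) (parity-zipWith-xor S T xs))
        (interchange (s ∧ x) (t ∧ x) (parity S xs) (parity T xs))

MAJ3-if-xor : ∀ a b c → MAJ3 a b c ≡ (if a xor b then c else a)
MAJ3-if-xor false false c = refl
MAJ3-if-xor false true  c = refl
MAJ3-if-xor true  false false = refl
MAJ3-if-xor true  false true  = refl
MAJ3-if-xor true  true  c = refl

_>>=_ : ∀ {n} → PDT n → (Bool → PDT n) → PDT n
leaf b       >>= h = h b
node S t₀ t₁ >>= h = node S (t₀ >>= h) (t₁ >>= h)

eval->>= : ∀ {n} (T : PDT n) h x → eval (T >>= h) x ≡ eval (h (eval T x)) x
eval->>= (leaf b) h x = refl
eval->>= (node S t₀ t₁) h x with parity S x
... | true  = eval->>= t₁ h x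
... | false = eval->>= t₀ h x

depth->>= : ∀ {n} (T : PDT n) h {d} → (∀ b → depth (h b) ≤ d) → depth (T >>= h) ≤ depth T + d
depth->>= (leaf b) h hd = hd b
depth->>= (node S t₀ t₁) h {d} hd = s≤s (⊔-lub
  (≤-trans (depth->>= t₀ h hd) (+-monoˡ-≤ d (m≤m⊔n (depth t₀) (depth t₁))))
  (≤-trans (depth->>= t₁ h hd) (+-monoˡ-≤ d (m≤n⊔m (depth t₀) (depth t₁)))))

query : ∀ {n} → Vec Bool n → PDT n
query S = node S (leaf false) (leaf true)

data MajFormula (n : ℕ) : ℕ → Set where
  par : Vec Bool n → MajFormula n 0
  maj : ∀ {j} → MajFormula n j → MajFormula n j → MajFormula n j → MajFormula n (suc j)

⟦_⟧ : ∀ {n j} → MajFormula n j → Vec Bool n → Bool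
⟦ par S ⟧ x = parity S x
⟦ maj a b c ⟧ x = MAJ3 (⟦ a ⟧ x) (⟦ b ⟧ x) (⟦ c ⟧ x)

majCost : ℕ → ℕ
majCost zero = 0
majCost (suc j) = suc (majCost j + majCost j + majCost j)

-- S is a parity accumulated but not yet queried; R S must output it ⊕-ed onto g.
ComputesShifted : ∀ {n} → (Vec Bool n → PDT n) → (Vec Bool n → Bool) → Set
ComputesShifted R g = ∀ S x → eval (R S) x ≡ parity S x xor g x

DepthBounded : ∀ {n} → (Vec Bool n → PDT n) → ℕ → Set
DepthBounded R d = ∀ S → depth (R S) ≤ d

query-computesShifted : ∀ {n} → ComputesShifted {n} query (λ _ → false)
query-computesShifted S x with parity S x
... | true  = refl
... | false = refl

query-depthBounded : ∀ {n} → DepthBounded {n} query 1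
query-depthBounded S = ≤-refl

formulaTree : ∀ {n j} → MajFormula n j → (Vec Bool n → PDT n) → Vec Bool n → PDT n
formulaTree (par T) R S = R (zipWith _xor_ S T)
formulaTree (maj a b c) R S =
  formulaTree a (formulaTree b query) (replicate _ false) >>= λ a⊕b →
  if a⊕b then formulaTree c R S else formulaTree a R S

formulaTree-computesShifted : ∀ {n j} (A : MajFormula n j) {R g} → ComputesShifted R g →
  ComputesShifted (formulaTree A R) (λ x → ⟦ A ⟧ x xor g x)
formulaTree-computesShifted (par T) {R} {g} hR S x = begin
  eval (R (zipWith _xor_ S T)) x           ≡⟨ hR (zipWith _xor_ S T) x ⟩
  parity (zipWith _xor_ S T) x xor g x     ≡⟨ cong (_xor g x) (parity-zipWith-xor S T x) ⟩
  (parity S x xor parity T x) xor g x      ≡⟨ xor-assoc (parity S x) (parity T x) (g x) ⟩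
  parity S x xor (parity T x xor g x)      ∎
  where open ≡-Reasoning
formulaTree-computesShifted (maj a b c) {R} {g} hR S x = begin
  eval (T >>= branch) x                                ≡⟨ eval->>= T branch x ⟩
  eval (branch (eval T x)) x                           ≡⟨ cong (λ r → eval (branch r) x) T-computes ⟩
  eval (branch a⊕b) x                                  ≡⟨ if-float (λ t → eval t x) a⊕b ⟩
  (if a⊕b then eval (formulaTree c R S) x else eval (formulaTree a R S) x)
    ≡⟨ cong₂ (if a⊕b then_else_) (formulaTree-computesShifted c hR S x)
                                  (formulaTree-computesShifted a hR S x) ⟩
  (if a⊕b then shift (⟦ c ⟧ x) else shift (⟦ a ⟧ x))  ≡⟨ if-float shift a⊕b ⟨
  shift (if a⊕b then ⟦ c ⟧ x else ⟦ a ⟧ x)            ≡⟨ cong shift (MAJ3-if-xor (⟦ a ⟧ x) (⟦ b ⟧ x) (⟦ c ⟧ x)) ⟨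
  shift (MAJ3 (⟦ a ⟧ x) (⟦ b ⟧ x) (⟦ c ⟧ x))          ∎
  where
  open ≡-Reasoning
  T = formulaTree a (formulaTree b query) (replicate _ false)
  branch = λ r → if r then formulaTree c R S else formulaTree a R S
  a⊕b = ⟦ a ⟧ x xor ⟦ b ⟧ x
  shift = λ v → parity S x xor (v xor g x)
  T-computes : eval T x ≡ a⊕b
  T-computes = trans
    (formulaTree-computesShifted a (formulaTree-computesShifted b query-computesShifted) _ x)
    (cong₂ _xor_ (parity-replicate-false x) (cong (⟦ a ⟧ x xor_) (xor-identityʳ (⟦ b ⟧ x))))

formulaTree-depthBounded : ∀ {n j} (A : MajFormula n j) {R d} → DepthBounded R d →
  DepthBounded (formulaTree A R) (d + majCost j)
formulaTree-depthBounded (par T) {R} {d} hR S =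
  subst (depth (R (zipWith _xor_ S T)) ≤_) (sym (+-identityʳ d)) (hR _)
formulaTree-depthBounded {j = suc j} (maj a b c) {R} {d} hR S =
  subst (depth (formulaTree (maj a b c) R S) ≤_) (cost-identity d (majCost j))
    (≤-trans (depth->>= T _ branch-depth) (+-monoˡ-≤ (d + majCost j) T-depth))
  where
  T = formulaTree a (formulaTree b query) (replicate _ false)
  T-depth : depth T ≤ 1 + majCost j + majCost j
  T-depth = formulaTree-depthBounded a (formulaTree-depthBounded b query-depthBounded) _
  branch-depth : ∀ r → depth (if r then formulaTree c R S else formulaTree a R S) ≤ d + majCost j
  branch-depth true  = formulaTree-depthBounded c hR S
  branch-depth false = formulaTree-depthBounded a hR S
  cost-identity : ∀ d c → (1 + c + c) + (d + c) ≡ d + suc (c + c + c)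
  cost-identity = solve-∀

recMajFormula : ∀ {n} k → Vec (Vec Bool n) (3 ^ k) → MajFormula n k
recMajFormula zero (S ∷ []) = par S
recMajFormula (suc k) Ss with split3 (3 ^ k) Ss
... | (a , b , c) = maj (recMajFormula k a) (recMajFormula k b) (recMajFormula k c)

split3-map : ∀ {A B : Set} (f : A → B) m (v : Vec A (m + (m + (m + 0)))) →
  split3 m (map f v) ≡ (let (a , b , c) = split3 m v in map f a , map f b , map f c)
split3-map f m v = cong₂ _,_ (take-map f m v) (cong₂ _,_ (take-drop-map v) third)
  where
  take-drop-map : ∀ {n} (u : Vec _ (m + (m + n))) →
    take m (drop m (map f u)) ≡ map f (take m (drop m u))
  take-drop-map u = trans (cong (take m) (drop-map f m u)) (take-map f m (drop m u))
  third : take m (drop m (drop m (map f v))) ≡ map f (take m (drop m (drop m v)))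
  third = trans (cong (λ u → take m (drop m u)) (drop-map f m v)) (take-drop-map (drop m v))

⟦⟧-recMajFormula : ∀ {n} k (Ss : Vec (Vec Bool n) (3 ^ k)) x →
  ⟦ recMajFormula k Ss ⟧ x ≡ RecMaj k (map (λ S → parity S x) Ss)
⟦⟧-recMajFormula zero (S ∷ []) x = refl
⟦⟧-recMajFormula (suc k) Ss x = trans (blocks (split3 m Ss))
  (cong (λ (a , b , c) → MAJ3 (RecMaj k a) (RecMaj k b) (RecMaj k c)) (sym (split3-map f m Ss)))
  where
  m = 3 ^ k
  f = λ S → parity S x
  blocks : ∀ ((a , b , c) : Vec (Vec Bool _) m × Vec (Vec Bool _) m × Vec (Vec Bool _) m) →
    ⟦ maj (recMajFormula k a) (recMajFormula k b) (recMajFormula k c) ⟧ x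
      ≡ MAJ3 (RecMaj k (map f a)) (RecMaj k (map f b)) (RecMaj k (map f c))
  blocks (a , b , c)
    rewrite ⟦⟧-recMajFormula k a x | ⟦⟧-recMajFormula k b x | ⟦⟧-recMajFormula k c x = refl

standardBasis : ∀ n → Vec (Vec Bool n) n
standardBasis zero = []
standardBasis (suc n) = (true ∷ replicate n false) ∷ map (false ∷_) (standardBasis n)

map-parity-standardBasis : ∀ {n} (x : Vec Bool n) → map (λ S → parity S x) (standardBasis n) ≡ x
map-parity-standardBasis [] = refl
map-parity-standardBasis (x ∷ xs) = cong₂ _∷_
  (trans (cong (x xor_) (parity-replicate-false xs)) (xor-identityʳ x))
  (trans (sym (map-∘ (λ S → parity S (x ∷ xs)) (false ∷_) (standardBasis _)))
         (map-parity-standardBasis xs))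

majCost-closedForm : ∀ k → suc (2 * majCost k) ≡ 3 ^ k
majCost-closedForm zero = refl
majCost-closedForm (suc k) = trans (arith (majCost k)) (cong (3 *_) (majCost-closedForm k))
  where
  arith : ∀ c → suc (2 * suc (c + c + c)) ≡ 3 * suc (2 * c)
  arith = solve-∀

[3^k+1]/2≡suc-majCost : ∀ k → (3 ^ k + 1) / 2 ≡ suc (majCost k)
[3^k+1]/2≡suc-majCost k = begin
  (3 ^ k + 1) / 2               ≡⟨ cong (λ t → (t + 1) / 2) (sym (majCost-closedForm k)) ⟩
  (suc (2 * majCost k) + 1) / 2 ≡⟨ cong (_/ 2) (arith (majCost k)) ⟩
  suc (majCost k) * 2 / 2       ≡⟨ m*n/n≡m (suc (majCost k)) 2 ⟩
  suc (majCost k)               ∎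
  where
  open ≡-Reasoning
  arith : ∀ c → suc (2 * c) + 1 ≡ suc c * 2
  arith = solve-∀

lemma12 : (k : ℕ) → 1 ≤ k →
    Σ (PDT (3 ^ k)) (λ T → Computes T (RecMaj k) × depth T ≤ (3 ^ k + 1) / 2)
-- The construction needs no lower bound on k.
lemma12 k _ = T , computes , subst (depth T ≤_) (sym ([3^k+1]/2≡suc-majCost k)) depth-bound
  where
  n = 3 ^ k
  A = recMajFormula k (standardBasis n)
  T = formulaTree A query (replicate n false)
  computes : Computes T (RecMaj k)
  computes x = begin
    eval T x                                  ≡⟨ formulaTree-computesShifted A query-computesShifted _ x ⟩
    parity (replicate n false) x xor (⟦ A ⟧ x xor false)
      ≡⟨ cong₂ _xor_ (parity-replicate-false x) (xor-identityʳ (⟦ A ⟧ x)) ⟩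
    ⟦ A ⟧ x                                   ≡⟨ ⟦⟧-recMajFormula k (standardBasis n) x ⟩
    RecMaj k (map (λ S → parity S x) (standardBasis n))
      ≡⟨ cong (RecMaj k) (map-parity-standardBasis x) ⟩
    RecMaj k x                                ∎
    where open ≡-Reasoning
  depth-bound : depth T ≤ suc (majCost k)
  depth-bound = formulaTree-depthBounded A query-depthBounded _
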